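{- Let $T$ be a string of length $n$ whose last character occurs nowhere else in $T$, let $T=f_1\cdots f_z$ be its LZ78 factorization, and let $z_i$ be the number of internal nodes of the LZ78 trie other than the root. Then $z+z_i\le n$.
   Context: LZ78 factorization: $T=f_1\cdots f_z$ where for each $x$, $f_x=f'_x c$ with $c$ a single character and $f'_x$ the longest string in $\{f_y:y<x\}\cup\{\varepsilon\}$ that is a prefix of the text remaining at the start of $f_x$. $f_x$ is a free letter if $f'_x=\varepsilon$, otherwise a referencing factor with referred factor $f_y=f'_x$. The LZ78 trie has a root (representing $\varepsilon$) and one node per factor $f_x$, which is a child of the node of $f_x$'s referred factor (or of the root if $f_x$ is a free letter). -}

module Defs where

open import Data.Nat using (ℕ; _≤_)
open import Data.List using (List; []; _∷_; _++_; [_]; length; map; filter)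
open import Data.List.Properties using (≡-dec)
open import Data.List.Membership.Propositional using (_∈_)
open import Data.List.Relation.Unary.Any using (any?)
open import Data.Product using (_×_; _,_; proj₁; ∃)
open import Data.Sum using (_⊎_)
open import Relation.Binary.PropositionalEquality using (_≡_)
open import Relation.Binary.Definitions using (DecidableEquality)

_IsPrefixOf_ : {A : Set} → List A → List A → Set
p IsPrefixOf t = ∃ λ s → p ++ s ≡ t

-- A factor f_x = f'_x c is represented by the pair (f'_x , c).
Factor : Set → Set
Factor A = List A × A

full : {A : Set} → Factor A → List A
full (p , c) = p ++ [ c ]

-- LZ78 prev t fs : fs is the LZ78 factorization of the remaining text t,
-- given that the previously produced factors are prev (in order).
data LZ78 {A : Set} : List (List A) → List A → List (Factor A) → Set where
  done : ∀ {prev} → LZ78 prev [] []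
  step : ∀ {prev p c rest fs}
       → (p ≡ [] ⊎ p ∈ prev)
       → (∀ q → (q ≡ [] ⊎ q ∈ prev) → q IsPrefixOf (p ++ c ∷ rest)
              → length q ≤ length p)
       → LZ78 (prev ++ [ p ++ [ c ] ]) rest fs
       → LZ78 prev (p ++ c ∷ rest) ((p , c) ∷ fs)

IsLZ78Factorization : {A : Set} → List A → List (Factor A) → Set
IsLZ78Factorization T fs = LZ78 [] T fs

-- Number of non-root internal nodes of the LZ78 trie: the number of
-- factors f_x (one trie node each) having a child, i.e. being the
-- referred factor f'_y of some factor f_y.
internalNodes : {A : Set} → DecidableEquality A → List (Factor A) → ℕ
internalNodes _≟_ fs =
  length (filter (λ f → any? (λ pc → ≡-dec _≟_ (proj₁ pc) f) fs) (map full fs))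

-- Write each factor as f'_x c. Summing lengths, n = z + Σ |f'_x|. Every
-- non-root internal node is a factor f_y that occurs as some referred part
-- f'_x; the factors are pairwise distinct, so there are at most as many
-- internal nodes as non-empty referred parts, and each of those contributes
-- at least 1 to Σ |f'_x|. Hence z_i ≤ Σ |f'_x| = n − z.
module Submission where

open import Defs
open import Data.Nat using (suc; _+_; _≤_; z≤n; s≤s)
open import Data.Nat.Properties
  using (≤-trans; ≤-reflexive; <-irrefl; m≤n+m; +-suc; +-comm; +-monoʳ-≤; +-commutativeSemigroup)
open import Algebra.Properties.CommutativeSemigroup +-commutativeSemigroup using (x∙yz≈y∙xz)
open import Data.List using (List; []; _∷_; _++_; [_]; length; map; filter)
open import Data.Nat.ListAction using (sum)
open import Data.List.Properties using (≡-dec; length-++; ++-assoc; ++-identityʳ)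
open import Data.List.Membership.Propositional using (_∈_; _∉_; find)
open import Data.List.Membership.Propositional.Properties
  using (∈-∃++; ∈-++⁺ˡ; ∈-++⁺ʳ; ∈-++⁻; ∈-filter⁻; ∈-map⁻; ∈-map⁺)
open import Data.List.Relation.Unary.Any using (Any; here; there; any?)
open import Data.List.Relation.Unary.All using ([]; lookup)
open import Data.List.Relation.Unary.AllPairs using ([]; _∷_)
open import Data.List.Relation.Unary.Unique.Propositional using (Unique)
import Data.List.Relation.Unary.Unique.Propositional.Properties as Unique
open import Data.Product using (_,_; proj₁)
open import Data.Sum using (_⊎_; inj₁; inj₂)
open import Data.Empty using (⊥-elim)
open import Relation.Binary.PropositionalEquality using (_≡_; _≢_; refl; sym; cong; subst; module ≡-Reasoning)
open import Relation.Binary.Definitions using (DecidableEquality)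
open import Relation.Unary using (Decidable)

module _ {A : Set} where

  Unique∧⊆⇒length≤ : {xs ys : List A} → Unique xs → (∀ {x} → x ∈ xs → x ∈ ys) → length xs ≤ length ys
  Unique∧⊆⇒length≤ {[]} _ _ = z≤n
  Unique∧⊆⇒length≤ {x ∷ xs} (x∉xs ∷ unique) xs⊆ys with ∈-∃++ (xs⊆ys (here refl))
  ... | us , vs , refl = begin
      suc (length xs)             ≤⟨ s≤s (Unique∧⊆⇒length≤ unique xs⊆us++vs) ⟩
      suc (length (us ++ vs))     ≡⟨ cong suc (length-++ us) ⟩
      suc (length us + length vs) ≡⟨ +-suc (length us) _ ⟨
      length us + suc (length vs) ≡⟨ length-++ us ⟨
      length (us ++ x ∷ vs)       ∎
    where
    open Data.Nat.Properties.≤-Reasoning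
    xs⊆us++vs : ∀ {y} → y ∈ xs → y ∈ us ++ vs
    xs⊆us++vs y∈xs with ∈-++⁻ us (xs⊆ys (there y∈xs))
    ... | inj₁ y∈us = ∈-++⁺ˡ y∈us
    ... | inj₂ (here refl) = ⊥-elim (lookup x∉xs y∈xs refl)
    ... | inj₂ (there y∈vs) = ∈-++⁺ʳ us y∈vs

  nonEmpties : List (List A) → List (List A)
  nonEmpties [] = []
  nonEmpties ([] ∷ xss) = nonEmpties xss
  nonEmpties ((x ∷ xs) ∷ xss) = (x ∷ xs) ∷ nonEmpties xss

  length-nonEmpties≤sum-length : ∀ xss → length (nonEmpties xss) ≤ sum (map length xss)
  length-nonEmpties≤sum-length [] = z≤n
  length-nonEmpties≤sum-length ([] ∷ xss) = length-nonEmpties≤sum-length xss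
  length-nonEmpties≤sum-length ((x ∷ xs) ∷ xss) =
    s≤s (≤-trans (length-nonEmpties≤sum-length xss) (m≤n+m _ (length xs)))

  ∈-nonEmpties⁺ : ∀ {xs xss} → xs ∈ xss → xs ≢ [] → xs ∈ nonEmpties xss
  ∈-nonEmpties⁺ {xss = [] ∷ _} (here refl) xs≢[] = ⊥-elim (xs≢[] refl)
  ∈-nonEmpties⁺ {xss = (_ ∷ _) ∷ _} (here refl) _ = here refl
  ∈-nonEmpties⁺ {xss = [] ∷ _} (there xs∈xss) xs≢[] = ∈-nonEmpties⁺ xs∈xss xs≢[]
  ∈-nonEmpties⁺ {xss = (_ ∷ _) ∷ _} (there xs∈xss) xs≢[] = there (∈-nonEmpties⁺ xs∈xss xs≢[])

  referred : List (Factor A) → List (List A)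
  referred = map proj₁

  full≢[] : (f : Factor A) → full f ≢ []
  full≢[] ([] , _) ()
  full≢[] (_ ∷ _ , _) ()

  length-LZ78 : ∀ {prev : List (List A)} {t fs} → LZ78 prev t fs → length t ≡ length fs + sum (map length (referred fs))
  length-LZ78 done = refl
  length-LZ78 (step {p = p} {c} {rest} {fs} _ _ lz) = begin
      length (p ++ c ∷ rest)                     ≡⟨ length-++ p ⟩
      length p + suc (length rest)               ≡⟨ cong (λ k → length p + suc k) (length-LZ78 lz) ⟩
      length p + suc (length fs + referredSum)   ≡⟨ +-suc (length p) _ ⟩
      suc (length p + (length fs + referredSum)) ≡⟨ cong suc (x∙yz≈y∙xz (length p) (length fs) _) ⟩
      suc (length fs + (length p + referredSum)) ∎
    where
    open ≡-Reasoning
    referredSum = sum (map length (referred fs))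

  -- The factor p c is a prefix of the remaining text longer than p, so by the
  -- maximality of p it cannot be a previous factor.
  new-factor-fresh : ∀ {prev : List (List A)} {p c rest}
    → (∀ q → (q ≡ [] ⊎ q ∈ prev) → q IsPrefixOf (p ++ c ∷ rest) → length q ≤ length p)
    → p ++ [ c ] ∉ prev
  new-factor-fresh {p = p} {c} {rest} maximal pc∈prev =
    <-irrefl refl (≤-trans (≤-reflexive (+-comm 1 (length p)))
      (subst (_≤ length p) (length-++ p) (maximal (p ++ [ c ]) (inj₂ pc∈prev) (rest , ++-assoc p [ c ] rest))))

  Unique-LZ78 : ∀ {prev : List (List A)} {t fs} → LZ78 prev t fs → Unique prev → Unique (prev ++ map full fs)
  Unique-LZ78 {prev} done unique = subst Unique (sym (++-identityʳ prev)) unique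
  Unique-LZ78 {prev} (step {p = p} {c} {fs = fs} _ maximal lz) unique =
    subst Unique (++-assoc prev [ p ++ [ c ] ] (map full fs))
      (Unique-LZ78 lz (Unique.++⁺ unique ([] ∷ []) λ { (pc∈prev , here refl) → new-factor-fresh maximal pc∈prev }))

lemma2 : {A : Set} (_≟_ : DecidableEquality A) (T′ : List A) (a : A)
         → a ∉ T′
         → (fs : List (Factor A))
         → IsLZ78Factorization (T′ ++ [ a ]) fs
         → length fs + internalNodes _≟_ fs ≤ length (T′ ++ [ a ])
-- The bound holds for every text, so the hypothesis on the last character is unused.
lemma2 {A} _≟_ T′ a _ fs lz = begin
    length fs + internalNodes _≟_ fs              ≤⟨ +-monoʳ-≤ (length fs) internal≤nonEmpty ⟩
    length fs + length (nonEmpties (referred fs)) ≤⟨ +-monoʳ-≤ (length fs) (length-nonEmpties≤sum-length (referred fs)) ⟩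
    length fs + sum (map length (referred fs))    ≡⟨ length-LZ78 lz ⟨
    length (T′ ++ [ a ])                          ∎
  where
  open Data.Nat.Properties.≤-Reasoning
  isReferred? : Decidable (λ (f : List A) → Any (λ pc → proj₁ pc ≡ f) fs)
  isReferred? f = any? (λ pc → ≡-dec _≟_ (proj₁ pc) f) fs
  internal⊆nonEmpty : ∀ {f} → f ∈ filter isReferred? (map full fs) → f ∈ nonEmpties (referred fs)
  internal⊆nonEmpty f∈internal with ∈-filter⁻ isReferred? {xs = map full fs} f∈internal
  ... | f∈factors , f-referred with ∈-map⁻ full {xs = fs} f∈factors | find f-referred
  ... | g , _ , refl | h , h∈fs , refl = ∈-nonEmpties⁺ (∈-map⁺ proj₁ h∈fs) (full≢[] g)
  internal≤nonEmpty : internalNodes _≟_ fs ≤ length (nonEmpties (referred fs))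
  internal≤nonEmpty = Unique∧⊆⇒length≤ (Unique.filter⁺ isReferred? (Unique-LZ78 lz [])) internal⊆nonEmpty
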